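{- Let $\alpha\in\mathcal{C}_n$, $i\in[n-1]$ and $z\in[\alpha_i]$. If $\alpha$ is $(i,z)$-removable, then there exists a unique composition $\alpha'$ such that $\alpha$ covers $\alpha'$ and $\alpha'_i=\alpha_i-z$; namely, $\alpha'$ is given by $\alpha'_i=\alpha_i-z$, $\alpha'_{\tilde J(i,z)}=\alpha_{\tilde J(i,z)}+z-1$, and $\alpha'_m=\alpha_m$ for $m\notin\{i,\tilde J(i,z)\}$.
   Context: $[n]=\{1,\dots,n\}$. A (weak) composition is a finite sequence of nonnegative integers $(\alpha_1,\dots,\alpha_m)$ with $\alpha_k=0$ for $k>m$; $|\alpha|=\sum\alpha_k$. $\mathcal{C}_n$ is the set of compositions $(\alpha_1,\dots,\alpha_{n-1})$ with $0\leqslant\alpha_i\leqslant n-i$. For a composition $\alpha$, a positive integer $i$ and $j\in\mathbb{N}$: $c_{i,j}(\alpha)=0$ if $j\leqslant i+1$; for $j>i+1$, $c_{i,j}(\alpha)=c_{i,j-1}(\alpha)+1$ if $\alpha_{j-1}<\alpha_i-c_{i,j-1}(\alpha)$ and $c_{i,j}(\alpha)=c_{i,j-1}(\alpha)$ otherwise. For compositions with $|\alpha|=|\alpha'|+1$, $\alpha$ covers $\alpha'$ if there are positive integers $i<j$ with: (a1) $\alpha'_i\leqslant\alpha_i-1$; (a2) $\alpha'_j=\alpha_j+\alpha_i-\alpha'_i-1$; (a3) $\alpha'_k=\alpha_k$ for $k\neq i,j$; (a4) $c_{i,j}(\alpha)=c_{i,j}(\alpha')=\alpha'_i-\alpha_j$.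 For $\alpha\in\mathcal{C}_n$, $i\in[n-1]$, $z\in[\alpha_i]$: $\alpha$ is $(i,z)$-removable if there exists a composition $\alpha'$ with $\alpha$ covering $\alpha'$ and $\alpha'_i=\alpha_i-z$. With $\tilde\alpha$ defined by $\tilde\alpha_i=\alpha_i-z$, $\tilde\alpha_m=\alpha_m$ ($m\neq i$), set $\tilde J(i,z)=\max\{j>i:c_{i,j}(\alpha)=c_{i,j}(\tilde\alpha)\}$ (this maximum exists). -}

module Defs where

open import Data.Nat using (ℕ; zero; suc; _+_; _∸_; _≤_; _<_; _≤?_; _<?_)
open import Data.List using (List; []; _∷_; length)
open import Data.Nat.ListAction using (sum)
open import Data.Product using (Σ; _×_; ∃)
open import Relation.Nullary using (¬_; does)
open import Relation.Binary.PropositionalEquality using (_≡_; _≢_)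
open import Data.Bool using (if_then_else_)

-- A composition is a finite list (α₁,…,αₘ); entries beyond the list are 0.
-- Compositions are compared entrywise (so trailing zeros are irrelevant).
Composition : Set
Composition = List ℕ

-- 1-based entry access, with αₖ = 0 beyond the list (index 0 unused, gives 0).
get : Composition → ℕ → ℕ
get [] _ = 0
get (x ∷ xs) zero = 0
get (x ∷ xs) (suc zero) = x
get (x ∷ xs) (suc (suc k)) = get xs (suc k)

size : Composition → ℕ
size = sum

_≈c_ : Composition → Composition → Set
α ≈c β = ∀ k → 1 ≤ k → get α k ≡ get β k

InC : ℕ → Composition → Set
InC n α = (length α ≡ n ∸ 1) × (∀ k → 1 ≤ k → k ≤ n ∸ 1 → get α k ≤ n ∸ k)

-- c_{i,j}(a), for a sequence a (indexed by positive integers).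
-- c_{i,j} = 0 if j ≤ i+1; otherwise c_{i,j} = c_{i,j-1} + [a_{j-1} < a_i - c_{i,j-1}].
-- (Natural subtraction is harmless: the condition forces a_i - c > 0.)
cc : (ℕ → ℕ) → ℕ → ℕ → ℕ
cc a i zero = 0
cc a i (suc j) =
  if does (suc (suc i) ≤? suc j)
  then (if does (a j <? (a i ∸ cc a i j)) then suc (cc a i j) else cc a i j)
  else 0

Covers : Composition → Composition → Set
Covers α α' =
  (size α ≡ size α' + 1) ×
  Σ ℕ λ i → Σ ℕ λ j → (1 ≤ i) × (i < j) ×
    (get α' i + 1 ≤ get α i) ×
    -- (a2) α'ⱼ = αⱼ + αᵢ - α'ᵢ - 1
    (get α' j + get α' i + 1 ≡ get α j + get α i) ×
    -- (a3) α'ₖ = αₖ for k ≠ i, j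
    (∀ k → 1 ≤ k → k ≢ i → k ≢ j → get α' k ≡ get α k) ×
    -- (a4) c_{i,j}(α) = c_{i,j}(α') = α'ᵢ - αⱼ
    (cc (get α) i j ≡ cc (get α') i j) ×
    (cc (get α) i j + get α j ≡ get α' i)

Removable : Composition → ℕ → ℕ → Set
Removable α i z = Σ Composition λ α' → Covers α α' × (get α' i ≡ get α i ∸ z)

-- α̃ : α with i-th entry replaced by αᵢ - z
tilde : Composition → ℕ → ℕ → ℕ → ℕ
tilde α i z m = if does (m Data.Nat.≟ i) then get α i ∸ z else get α m

IsTildeJ : Composition → ℕ → ℕ → ℕ → Set
IsTildeJ α i z J =
  (i < J) × (cc (get α) i J ≡ cc (tilde α i z) i J) ×
  (∀ j → J < j → cc (get α) i j ≢ cc (tilde α i z) i j)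

ExplicitForm : Composition → ℕ → ℕ → ℕ → Composition → Set
ExplicitForm α i z J α' =
  (get α' i ≡ get α i ∸ z) ×
  (get α' J ≡ get α J + (z ∸ 1)) ×
  (∀ m → 1 ≤ m → m ≢ i → m ≢ J → get α' m ≡ get α m)

module Submission where

-- Only the first cover index can decrease an entry, so any α' covered by α with α'ᵢ = αᵢ − z
-- comes from a pair (i, j), and (a2), (a3) then determine α' from j; it remains to show
-- j = J̃(i,z). Below j, α' agrees with α̃, so (a4) gives c_{i,j}(α) = c_{i,j}(α̃); moreover (a4)
-- puts α_j exactly at the threshold αᵢ − z − c of α̃ but strictly below the threshold αᵢ − c of α,
-- so at j+1 the counter of α̃ falls behind. Since c(α) ≤ z + c(α̃) throughout, the threshold
-- of α̃ never exceeds that of α: whenever the counter of α̃ steps so does that of α, and it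
-- never catches up.

open import Data.Nat
open import Data.Nat.Properties
open import Data.Product using (Σ; _×_; _,_)
open import Data.Empty using (⊥-elim)
open import Function using (_∘_)
open import Relation.Nullary using (¬_; yes; no)
open import Relation.Nullary.Decidable using (dec-true; dec-false)
open import Relation.Binary.PropositionalEquality
open import Relation.Binary.Definitions using (tri<; tri≈; tri>)
open import Data.Nat.Solver using (module +-*-Solver)
open import Defs

m+n≡o∸p⇒o∸m≡n+p : ∀ {m n o p} → m + n ≡ o ∸ p → p ≤ o → o ∸ m ≡ n + p
m+n≡o∸p⇒o∸m≡n+p {m} {n} {o} {p} m+n≡o∸p p≤o = begin
  o ∸ m               ≡⟨ cong (_∸ m) (sym (m∸n+n≡m p≤o)) ⟩
  (o ∸ p + p) ∸ m     ≡⟨ cong (λ x → (x + p) ∸ m) (sym m+n≡o∸p) ⟩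
  (m + n + p) ∸ m     ≡⟨ cong (_∸ m) (+-assoc m n p) ⟩
  (m + (n + p)) ∸ m   ≡⟨ m+n∸m≡n m (n + p) ⟩
  n + p               ∎
  where open ≡-Reasoning

n+[o∸p]+1≡m+o⇒n≡m+[p∸1] : ∀ {m n o p} → 1 ≤ p → p ≤ o → n + (o ∸ p) + 1 ≡ m + o → n ≡ m + (p ∸ 1)
n+[o∸p]+1≡m+o⇒n≡m+[p∸1] {m} {n} {o} {suc p} _ p≤o sums =
  +-cancelʳ-≡ (o ∸ suc p) _ _ (+-cancelʳ-≡ 1 _ _ (begin
    n + (o ∸ suc p) + 1         ≡⟨ sums ⟩
    m + o                       ≡⟨ cong (m +_) (sym (m∸n+n≡m p≤o)) ⟩
    m + (o ∸ suc p + suc p)     ≡⟨ solve 3 (λ x c y → x :+ (c :+ (con 1 :+ y)) := x :+ y :+ c :+ con 1)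
                                         refl m (o ∸ suc p) p ⟩
    m + p + (o ∸ suc p) + 1     ∎))
  where
    open ≡-Reasoning
    open +-*-Solver

cc-suc-reset : ∀ a i j → ¬ (i < j) → cc a i (suc j) ≡ 0
cc-suc-reset a i j i≮j rewrite dec-false (suc (suc i) ≤? suc j) (i≮j ∘ s≤s⁻¹) = refl

cc-suc-increment : ∀ a i j → i < j → a j < a i ∸ cc a i j → cc a i (suc j) ≡ suc (cc a i j)
cc-suc-increment a i j i<j below
  rewrite dec-true (suc (suc i) ≤? suc j) (s≤s i<j)
        | dec-true (a j <? a i ∸ cc a i j) below = refl

cc-suc-constant : ∀ a i j → i < j → ¬ (a j < a i ∸ cc a i j) → cc a i (suc j) ≡ cc a i j
cc-suc-constant a i j i<j ¬below
  rewrite dec-true (suc (suc i) ≤? suc j) (s≤s i<j)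
        | dec-false (a j <? a i ∸ cc a i j) ¬below = refl

cc-suc-cong : ∀ {a b} i j → a j ≡ b j → a i ≡ b i → cc a i j ≡ cc b i j →
              cc a i (suc j) ≡ cc b i (suc j)
cc-suc-cong i j eqⱼ eqᵢ eqc rewrite eqⱼ | eqᵢ | eqc = refl

cc-cong-below : ∀ {a b} i J → 1 ≤ i → (∀ k → 1 ≤ k → k < J → a k ≡ b k) →
                ∀ j → j ≤ J → cc a i j ≡ cc b i j
cc-cong-below i J 1≤i agree zero _ = refl
cc-cong-below {a} {b} i J 1≤i agree (suc j) j<J with i <? j
... | no i≮j = trans (cc-suc-reset a i j i≮j) (sym (cc-suc-reset b i j i≮j))
... | yes i<j = cc-suc-cong i j (agree j (≤-trans 1≤i (<⇒≤ i<j)) j<J)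
                                (agree i 1≤i (<-trans i<j j<J))
                                (cc-cong-below i J 1≤i agree j (<⇒≤ j<J))

module Lowered (a b : ℕ → ℕ) {i z : ℕ}
               (bᵢ : b i ≡ a i ∸ z) (b-above : ∀ k → i < k → b k ≡ a k) where

  b-threshold : ∀ j → b i ∸ cc b i j ≡ a i ∸ (z + cc b i j)
  b-threshold j = trans (cong (_∸ cc b i j) bᵢ) (∸-+-assoc (a i) z (cc b i j))

  b-step⇒a-step : ∀ j → i < j → cc a i j ≤ z + cc b i j →
                  b j < b i ∸ cc b i j → a j < a i ∸ cc a i j
  b-step⇒a-step j i<j gap≤z b-step = begin-strict
    a j                    ≡⟨ sym (b-above j i<j) ⟩
    b j                    <⟨ b-step ⟩
    b i ∸ cc b i j         ≡⟨ b-threshold j ⟩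
    a i ∸ (z + cc b i j)   ≤⟨ ∸-monoʳ-≤ (a i) gap≤z ⟩
    a i ∸ cc a i j         ∎
    where open ≤-Reasoning

  a-step∧b-constant⇒cc<z+cc : ∀ j → i < j → a j < a i ∸ cc a i j →
                            ¬ (b j < b i ∸ cc b i j) → cc a i j < z + cc b i j
  a-step∧b-constant⇒cc<z+cc j i<j a-step ¬b-step = ∸-cancelʳ-< (begin-strict
    a i ∸ (z + cc b i j)   ≡⟨ sym (b-threshold j) ⟩
    b i ∸ cc b i j         ≤⟨ ≮⇒≥ ¬b-step ⟩
    b j                    ≡⟨ b-above j i<j ⟩
    a j                    <⟨ a-step ⟩
    a i ∸ cc a i j         ∎)
    where open ≤-Reasoning

  cc≤z+cc : ∀ j → cc a i j ≤ z + cc b i j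
  cc≤z+cc zero = z≤n
  cc≤z+cc (suc j) with i <? j
  ... | no i≮j rewrite cc-suc-reset a i j i≮j = z≤n
  ... | yes i<j with a j <? a i ∸ cc a i j | b j <? b i ∸ cc b i j
  ...   | yes a-step | yes b-step
    rewrite cc-suc-increment a i j i<j a-step | cc-suc-increment b i j i<j b-step | +-suc z (cc b i j)
    = s≤s (cc≤z+cc j)
  ...   | yes a-step | no ¬b-step
    rewrite cc-suc-increment a i j i<j a-step | cc-suc-constant b i j i<j ¬b-step
    = a-step∧b-constant⇒cc<z+cc j i<j a-step ¬b-step
  ...   | no ¬a-step | yes b-step = ⊥-elim (¬a-step (b-step⇒a-step j i<j (cc≤z+cc j) b-step))
  ...   | no ¬a-step | no ¬b-step
    rewrite cc-suc-constant a i j i<j ¬a-step | cc-suc-constant b i j i<j ¬b-step = cc≤z+cc j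

  cc-gap-step : ∀ j → i < j → cc b i j < cc a i j → cc b i (suc j) < cc a i (suc j)
  cc-gap-step j i<j gap with a j <? a i ∸ cc a i j | b j <? b i ∸ cc b i j
  ... | yes a-step | yes b-step
    rewrite cc-suc-increment a i j i<j a-step | cc-suc-increment b i j i<j b-step = s≤s gap
  ... | yes a-step | no ¬b-step
    rewrite cc-suc-increment a i j i<j a-step | cc-suc-constant b i j i<j ¬b-step = m<n⇒m<1+n gap
  ... | no ¬a-step | yes b-step =
    ⊥-elim (¬a-step (b-step⇒a-step j i<j (cc≤z+cc j) b-step))
  ... | no ¬a-step | no ¬b-step
    rewrite cc-suc-constant a i j i<j ¬a-step | cc-suc-constant b i j i<j ¬b-step = gap

  cc-gap-persists : ∀ {j j'} → i < j → j ≤′ j' → cc b i j < cc a i j → cc b i j' < cc a i j'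
  cc-gap-persists i<j ≤′-refl gap = gap
  cc-gap-persists i<j (≤′-step j≤′j') gap =
    cc-gap-step _ (<-≤-trans i<j (≤′⇒≤ j≤′j')) (cc-gap-persists i<j j≤′j' gap)

tilde-at : ∀ α i z → tilde α i z i ≡ get α i ∸ z
tilde-at α i z rewrite dec-true (i ≟ i) refl = refl

tilde-other : ∀ α i z k → k ≢ i → tilde α i z k ≡ get α k
tilde-other α i z k k≢i rewrite dec-false (k ≟ i) k≢i = refl

cover-second-index-≥ : ∀ {α β i j} → get β i + 1 ≤ get α i →
                       get β j + get β i + 1 ≡ get α j + get α i → get α j ≤ get β j
cover-second-index-≥ {α} {β} {i} {j} decrease sums = +-cancelʳ-≤ (get α i) (get α j) (get β j) (begin
  get α j + get α i         ≡⟨ sym sums ⟩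
  get β j + get β i + 1     ≡⟨ +-assoc (get β j) (get β i) 1 ⟩
  get β j + (get β i + 1)   ≤⟨ +-monoʳ-≤ (get β j) decrease ⟩
  get β j + get α i         ∎)
  where open ≤-Reasoning

decrease⇒first-cover-index : ∀ {α β i j k} → get β i + 1 ≤ get α i →
  get β j + get β i + 1 ≡ get α j + get α i →
  (∀ m → 1 ≤ m → m ≢ i → m ≢ j → get β m ≡ get α m) →
  1 ≤ k → get β k < get α k → k ≡ i
decrease⇒first-cover-index {α} {β} {i} {j} {k} decrease sums unchanged 1≤k βₖ<αₖ with k ≟ i | k ≟ j
... | yes k≡i | _ = k≡i
... | no _ | yes refl = ⊥-elim (<⇒≱ βₖ<αₖ (cover-second-index-≥ {α} {β} decrease sums))
... | no k≢i | no k≢j = ⊥-elim (<⇒≢ βₖ<αₖ (unchanged k 1≤k k≢i k≢j))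

tildeJ-unique : ∀ {α i z J J'} → IsTildeJ α i z J → IsTildeJ α i z J' → J ≡ J'
tildeJ-unique {J = J} {J'} (_ , eq , eq-beyond) (_ , eq' , eq'-beyond) with <-cmp J J'
... | tri< J<J' _ _ = ⊥-elim (eq-beyond J' J<J' eq')
... | tri≈ _ J≡J' _ = J≡J'
... | tri> _ _ J'<J = ⊥-elim (eq'-beyond J J'<J eq)

module Lowering (α : Composition) {i z : ℕ} (1≤i : 1 ≤ i) (1≤z : 1 ≤ z) (z≤αᵢ : z ≤ get α i) where

  α̃ : ℕ → ℕ
  α̃ = tilde α i z

  open Lowered (get α) α̃ {i} {z} (tilde-at α i z) (λ k i<k → tilde-other α i z k (>⇒≢ i<k))

  second-cover-index-isTildeJ : ∀ {β j} → i < j →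
    (∀ k → 1 ≤ k → k ≢ i → k ≢ j → get β k ≡ get α k) →
    cc (get α) i j ≡ cc (get β) i j → cc (get α) i j + get α j ≡ get β i →
    get β i ≡ get α i ∸ z → IsTildeJ α i z j
  second-cover-index-isTildeJ {β} {j} i<j unchanged ccα≡ccβ c+αⱼ≡βᵢ βᵢ =
    i<j , ccα≡ccα̃ , λ j' j<j' eq → <⇒≢ (cc-gap-persists (m<n⇒m<1+n i<j) (≤⇒≤′ j<j') gap) (sym eq)
    where
      c : ℕ
      c = cc (get α) i j

      c+αⱼ : c + get α j ≡ get α i ∸ z
      c+αⱼ = trans c+αⱼ≡βᵢ βᵢ

      β≡α̃-below : ∀ k → 1 ≤ k → k < j → get β k ≡ α̃ k
      β≡α̃-below k 1≤k k<j with k ≟ i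
      ... | yes refl = trans βᵢ (sym (tilde-at α i z))
      ... | no k≢i = trans (unchanged k 1≤k k≢i (<⇒≢ k<j)) (sym (tilde-other α i z k k≢i))

      ccα≡ccα̃ : c ≡ cc α̃ i j
      ccα≡ccα̃ = trans ccα≡ccβ (cc-cong-below i j 1≤i β≡α̃-below j ≤-refl)

      α-step : get α j < get α i ∸ c
      α-step = subst (get α j <_) (sym (m+n≡o∸p⇒o∸m≡n+p c+αⱼ z≤αᵢ)) (m<m+n (get α j) 1≤z)

      α̃-threshold : α̃ i ∸ cc α̃ i j ≡ α̃ j
      α̃-threshold = begin
        α̃ i ∸ cc α̃ i j      ≡⟨ cong₂ _∸_ (tilde-at α i z) (sym ccα≡ccα̃) ⟩
        (get α i ∸ z) ∸ c   ≡⟨ cong (_∸ c) (sym c+αⱼ) ⟩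
        (c + get α j) ∸ c   ≡⟨ m+n∸m≡n c (get α j) ⟩
        get α j             ≡⟨ sym (tilde-other α i z j (>⇒≢ i<j)) ⟩
        α̃ j                 ∎
        where open ≡-Reasoning

      gap : cc α̃ i (suc j) < cc (get α) i (suc j)
      gap = begin-strict
        cc α̃ i (suc j)         ≡⟨ cc-suc-constant α̃ i j i<j (<-irrefl (sym α̃-threshold)) ⟩
        cc α̃ i j               ≡⟨ sym ccα≡ccα̃ ⟩
        c                      <⟨ n<1+n c ⟩
        suc c                  ≡⟨ sym (cc-suc-increment (get α) i j i<j α-step) ⟩
        cc (get α) i (suc j)   ∎
        where open ≤-Reasoning

  cover-explicitForm : ∀ {β j} → get β i ≡ get α i ∸ z →
    get β j + get β i + 1 ≡ get α j + get α i →
    (∀ k → 1 ≤ k → k ≢ i → k ≢ j → get β k ≡ get α k) → ExplicitForm α i z j β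
  cover-explicitForm {β} {j} βᵢ sums unchanged =
    βᵢ , n+[o∸p]+1≡m+o⇒n≡m+[p∸1] 1≤z z≤αᵢ (subst (λ x → get β j + x + 1 ≡ _) βᵢ sums) , unchanged

  lowering-cover : ∀ β → Covers α β → get β i ≡ get α i ∸ z →
                   Σ ℕ λ J → IsTildeJ α i z J × ExplicitForm α i z J β
  lowering-cover β (_ , _ , j , _ , i<j , decrease , sums , unchanged , ccα≡ccβ , c+αⱼ≡βᵢ) βᵢ
    with decrease⇒first-cover-index {α} {β} decrease sums unchanged 1≤i
           (subst (_< get α i) (sym βᵢ) (∸-monoʳ-< 1≤z z≤αᵢ))
  ... | refl = j , second-cover-index-isTildeJ {β} i<j unchanged ccα≡ccβ c+αⱼ≡βᵢ βᵢ
                 , cover-explicitForm {β} βᵢ sums unchanged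

  lowering-cover-explicitForm : ∀ β {J} → Covers α β → get β i ≡ get α i ∸ z →
                                IsTildeJ α i z J → ExplicitForm α i z J β
  lowering-cover-explicitForm β α⋗β βᵢ J-isTildeJ with lowering-cover β α⋗β βᵢ
  ... | J' , J'-isTildeJ , form
    rewrite tildeJ-unique {α} {i} {z} J-isTildeJ J'-isTildeJ = form

open Lowering using (lowering-cover; lowering-cover-explicitForm)

lemma3p4 : (n : ℕ) (α : Composition) (i z : ℕ) →
    InC n α → 1 ≤ i → i ≤ n ∸ 1 → 1 ≤ z → z ≤ get α i →
    Removable α i z →
    Σ ℕ λ J → IsTildeJ α i z J ×
      (Σ Composition λ α' → Covers α α' × ExplicitForm α i z J α') ×
      (∀ β → Covers α β → get β i ≡ get α i ∸ z → ExplicitForm α i z J β)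
lemma3p4 n α i z _ 1≤i _ 1≤z z≤αᵢ (α' , α⋗α' , α'ᵢ)
  with J , J-isTildeJ , form ← lowering-cover α 1≤i 1≤z z≤αᵢ α' α⋗α' α'ᵢ
  = J , J-isTildeJ , (α' , α⋗α' , form)
  , λ β α⋗β βᵢ → lowering-cover-explicitForm α 1≤i 1≤z z≤αᵢ β α⋗β βᵢ J-isTildeJ
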